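{- For $n\geq 1$ and $0\leq m<n$, $$S_{n,m}(0121,0132)=S_{n,m}(0121,1032)=S_{n,m}(0122,0132)=S_{n,m}(0122,1032).$$
   Context: An ascent in a sequence $x_1\cdots x_k$ is an index $j\ge1$ with $x_j<x_{j+1}$; $\mathrm{asc}$ counts ascents. An ascent sequence of length $n$ is a sequence $x_1\cdots x_n$ of non-negative integers with $x_1=0$ and $x_i\leq \mathrm{asc}(x_1\cdots x_{i-1})+1$ for $1<i\le n$. A sequence $\pi$ contains a pattern $\tau=\tau_1\cdots\tau_k$ (finite sequence of non-negative integers) if some subsequence $\pi_{f(1)}\cdots\pi_{f(k)}$ ($f$ strictly increasing) satisfies $\pi_{f(i)}<\pi_{f(j)}$ iff $\tau_i<\tau_j$ and $\pi_{f(i)}>\pi_{f(j)}$ iff $\tau_i>\tau_j$ for all $i,j$; otherwise $\pi$ avoids $\tau$. $S_{n,m}(u,v)$ is the number of ascent sequences of length $n$ with exactly $m$ ascents avoiding both patterns $u$ and $v$. -}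

module Defs where

open import Data.Nat using (ℕ; zero; suc; _+_; _<ᵇ_; _≡ᵇ_)
open import Data.Bool using (Bool; true; false; _∧_; not; if_then_else_; T)
open import Data.List using (List; []; _∷_; _++_; length; map; filter; concatMap; upTo)
open import Data.Bool.ListAction using (all; any)
open import Data.Bool.Properties using (T?)
open import Data.Product using (_×_; _,_)

asc : List ℕ → ℕ
asc [] = 0
asc (x ∷ []) = 0
asc (x ∷ y ∷ xs) = (if x <ᵇ y then 1 else 0) + asc (y ∷ xs)

ascOK : List ℕ → List ℕ → Bool
ascOK pre [] = true
ascOK pre (x ∷ xs) = (x <ᵇ asc pre + 2) ∧ ascOK (pre ++ (x ∷ [])) xs

-- ascent sequence: x₁ = 0 and x_i ≤ asc(x₁⋯x_{i-1}) + 1 for 1 < i ≤ n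
-- (the empty sequence is irrelevant here since n ≥ 1)
isAscentSeq : List ℕ → Bool
isAscentSeq [] = true
isAscentSeq (x ∷ xs) = (x ≡ᵇ 0) ∧ ascOK (x ∷ []) xs

lists : ℕ → ℕ → List (List ℕ)
lists b zero = [] ∷ []
lists b (suc n) = concatMap (λ x → map (x ∷_) (lists b n)) (upTo b)

subseqs : ℕ → List ℕ → List (List ℕ)
subseqs zero xs = [] ∷ []
subseqs (suc k) [] = []
subseqs (suc k) (x ∷ xs) = map (x ∷_) (subseqs k xs) ++ subseqs (suc k) xs

_≡ᴮ_ : Bool → Bool → Bool
true ≡ᴮ y = y
false ≡ᴮ y = not y

zipP : List ℕ → List ℕ → List (ℕ × ℕ)
zipP (a ∷ as) (b ∷ bs) = (a , b) ∷ zipP as bs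
zipP _ _ = []

orderIso : List ℕ → List ℕ → Bool
orderIso ρ τ = (length ρ ≡ᵇ length τ) ∧
  all (λ p → all (λ q → agree p q) ps) ps
  where
  ps = zipP ρ τ
  agree : ℕ × ℕ → ℕ × ℕ → Bool
  agree (a , c) (b , d) = ((a <ᵇ b) ≡ᴮ (c <ᵇ d)) ∧ ((b <ᵇ a) ≡ᴮ (d <ᵇ c))

contains : List ℕ → List ℕ → Bool
contains π τ = any (λ ρ → orderIso ρ τ) (subseqs (length τ) π)

avoids : List ℕ → List ℕ → Bool
avoids π τ = not (contains π τ)

-- Every ascent sequence of length n has entries ≤ n - 1
-- (x_i ≤ asc(prefix)+1 ≤ i-1), so enumerating lists with entries < n is exhaustive.
S : ℕ → ℕ → List ℕ → List ℕ → ℕ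
S n m u v = length (filter (λ x → T? (isAscentSeq x ∧ (asc x ≡ᵇ m) ∧ avoids x u ∧ avoids x v)) (lists n n))

-- Among ascent sequences, those avoiding 0121 and τ (τ = 0132 or 1032) are exactly those in which every
-- nonzero entry is a weak left-to-right maximum, and those avoiding 0122 and τ are exactly those in which
-- every entry ≥ 2 is a strict left-to-right maximum.
-- Conversely, let v break the rule and let c be the first entry ≥ t, where t = v + 1 (resp. t = v); it comes
-- before v.  Before c there is either a descent y > z with y < t, or the entries are weakly increasing, and
-- then the ascent condition c ≤ asc + 1 ≤ (previous entry) + 1 forces c = t right after t − 1.  So one of 0 y z c v,
-- 0 y c v, 0 (t − 1) t v is a subsequence, and it is an occurrence of τ, 0121 or 0122.
-- The two classes are equinumerous for every length n and number of ascents m: reading left to right and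
-- exchanging the values 1 and M, where M ≥ 2 is the largest entry read so far, is an involution on the
-- sequences with entries below n which preserves ascents and maps one class onto the other.
module Submission where

open import Defs
open import Data.Nat using (ℕ; _≤_; _<_)
open import Data.List using (List; []; _∷_)
open import Relation.Binary.PropositionalEquality using (_≡_)
open import Data.Product using (_×_)

open import Algebra.Properties.CommutativeSemigroup using (xy∙z≈zy∙x)
open import Data.Bool using (Bool; true; false; T; _∧_; _∨_; not; if_then_else_)
open import Data.Bool.Properties using (T?; T-≡; T-∧; T-∨)
open import Data.Empty using (⊥-elim)
open import Data.Fin using (#_)
import Data.Fin as Fin
open import Data.List using (_++_; length; map; filter; concatMap; applyUpTo; upTo; lookup)
open import Data.List.Membership.Propositional using (_∈_; find; lose)
open import Data.List.Membership.Propositional.Properties using (∈-map⁺; ∈-map⁻; ∈-++⁺ˡ; ∈-++⁺ʳ; ∈-++⁻)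
open import Data.List.Properties using (map-cong; map-upTo; length-map; ++-assoc)
open import Data.List.Relation.Binary.Sublist.Propositional
  using (_⊆_; []; _∷_; _∷ʳ_; ⊆-refl; ⊆-trans; minimum; to∈)
open import Data.List.Relation.Binary.Sublist.Propositional.Properties using (++⁺; ++⁺ˡ; ++⁺ʳ)
open import Data.List.Relation.Unary.All using (all?)
import Data.List.Relation.Unary.All as All
open import Data.List.Relation.Unary.All.Properties using (all⁺; all⁻) renaming (map⁺ to All-map⁺)
open import Data.List.Relation.Unary.Any using (Any; here; there)
import Data.List.Relation.Unary.Any as Any
open import Data.List.Relation.Unary.Any.Properties using (any⁺; any⁻)
open import Data.Nat using (zero; suc; _+_; _⊔_; _<ᵇ_; _≤ᵇ_; _≡ᵇ_; z≤n; s≤s; z<s; s<s)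
open import Data.Nat.ListAction using (sum)
open import Data.Nat.Properties
open import Data.Product using (_,_; proj₁; proj₂; ∃; ∃₂)
import Data.Product as Product
open import Data.Sum using (_⊎_; inj₁; inj₂; map₂)
import Data.Sum as Sum
open import Data.Unit using (tt)
open import Function using (_∘_; id)
open import Function.Bundles using (Equivalence)
open import Relation.Binary.Definitions using (tri<; tri≈; tri>)
open import Relation.Binary.PropositionalEquality
  using (_≢_; _≗_; refl; sym; trans; cong; cong₂; subst; module ≡-Reasoning)
open import Relation.Nullary using (¬_; yes; no; contradiction)
open import Relation.Nullary.Decidable using (True; toWitness)

T-∧⁻ : ∀ {x y} → T (x ∧ y) → T x × T y
T-∧⁻ = Equivalence.to T-∧

T-∧⁺ : ∀ {x y} → T x → T y → T (x ∧ y)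
T-∧⁺ p q = Equivalence.from T-∧ (p , q)

T-∨⁻ : ∀ {x y} → T (x ∨ y) → T x ⊎ T y
T-∨⁻ = Equivalence.to T-∨

T-∨⁺ʳ : ∀ {x y} → T y → T (x ∨ y)
T-∨⁺ʳ q = Equivalence.from T-∨ (inj₂ q)

T-ext : ∀ {x y} → (T x → T y) → (T y → T x) → x ≡ y
T-ext {false} {false} _ _ = refl
T-ext {false} {true}  _ g = ⊥-elim (g tt)
T-ext {true}  {false} f _ = ⊥-elim (f tt)
T-ext {true}  {true}  _ _ = refl

not∧not≡ : ∀ {c₁ c₂ g : Bool} → (T g → ¬ T c₁ × ¬ T c₂) → (¬ T g → T c₁ ⊎ T c₂) → (not c₁ ∧ not c₂) ≡ g
not∧not≡ {false} {false} {true}  _ _ = refl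
not∧not≡ {true}  {_}     {true}  h _ = contradiction tt (proj₁ (h tt))
not∧not≡ {false} {true}  {true}  h _ = contradiction tt (proj₂ (h tt))
not∧not≡ {true}  {_}     {false} _ _ = refl
not∧not≡ {false} {true}  {false} _ _ = refl
not∧not≡ {false} {false} {false} _ h = ⊥-elim (Sum.[ id , id ] (h id))

≡ᵇ-refl : ∀ n → (n ≡ᵇ n) ≡ true
≡ᵇ-refl n = Equivalence.to T-≡ (≡⇒≡ᵇ n n refl)

≡ᵇ-false : ∀ {m n} → m ≢ n → (m ≡ᵇ n) ≡ false
≡ᵇ-false {m} {n} m≢n with m ≡ᵇ n in eq
... | false = refl
... | true  = contradiction (≡ᵇ⇒≡ m n (Equivalence.from T-≡ eq)) m≢n

<ᵇ-true : ∀ {m n} → m < n → (m <ᵇ n) ≡ true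
<ᵇ-true m<n = Equivalence.to T-≡ (<⇒<ᵇ m<n)

<ᵇ-false : ∀ {m n} → n ≤ m → (m <ᵇ n) ≡ false
<ᵇ-false {m}     {zero}  _         = refl
<ᵇ-false {suc m} {suc n} (s≤s n≤m) = <ᵇ-false n≤m

count : {A : Set} → (A → Bool) → List A → ℕ
count p []       = 0
count p (x ∷ xs) = (if p x then 1 else 0) + count p xs

length-filter-T? : ∀ {A : Set} (p : A → Bool) xs → length (filter (T? ∘ p) xs) ≡ count p xs
length-filter-T? p []       = refl
length-filter-T? p (x ∷ xs) with p x
... | true  = cong suc (length-filter-T? p xs)
... | false = length-filter-T? p xs

count-cong : ∀ {A : Set} {p q : A → Bool} → p ≗ q → count p ≗ count q
count-cong p≗q []       = refl
count-cong p≗q (x ∷ xs) = cong₂ (λ b n → (if b then 1 else 0) + n) (p≗q x) (count-cong p≗q xs)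

count-++ : ∀ {A : Set} (p : A → Bool) xs ys → count p (xs ++ ys) ≡ count p xs + count p ys
count-++ p []       ys = refl
count-++ p (x ∷ xs) ys =
  trans (cong (_ +_) (count-++ p xs ys)) (sym (+-assoc (if p x then 1 else 0) (count p xs) (count p ys)))

count-map : ∀ {A B : Set} (p : B → Bool) (f : A → B) xs → count p (map f xs) ≡ count (p ∘ f) xs
count-map p f []       = refl
count-map p f (x ∷ xs) = cong (_ +_) (count-map p f xs)

count-concatMap : ∀ {A B : Set} (p : B → Bool) (f : A → List B) xs →
  count p (concatMap f xs) ≡ sum (map (count p ∘ f) xs)
count-concatMap p f []       = refl
count-concatMap p f (x ∷ xs) =
  trans (count-++ p (f x) (concatMap f xs)) (cong (count p (f x) +_) (count-concatMap p f xs))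

count-lists-suc : ∀ (p : List ℕ → Bool) b k →
  count p (lists b (suc k)) ≡ sum (applyUpTo (λ v → count (p ∘ (v ∷_)) (lists b k)) b)
count-lists-suc p b k = trans (count-concatMap p _ (upTo b)) (cong sum (trans
  (map-cong (λ v → count-map p (v ∷_) (lists b k)) (upTo b))
  (map-upTo (λ v → count (p ∘ (v ∷_)) (lists b k)) b)))

sum-applyUpTo-cong : ∀ {f g : ℕ → ℕ} n → (∀ {i} → i < n → f i ≡ g i) →
  sum (applyUpTo f n) ≡ sum (applyUpTo g n)
sum-applyUpTo-cong                 zero    f≡g = refl
sum-applyUpTo-cong {f = f} {g = g} (suc n) f≡g =
  cong₂ _+_ (f≡g z<s) (sum-applyUpTo-cong {f ∘ suc} {g ∘ suc} n (f≡g ∘ s<s))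

sum-applyUpTo-update : ∀ n (f g : ℕ → ℕ) {j} → j < n → (∀ {i} → i ≢ j → f i ≡ g i) →
  sum (applyUpTo f n) + g j ≡ sum (applyUpTo g n) + f j
sum-applyUpTo-update (suc n) f g {zero} _ f≡g
  rewrite sum-applyUpTo-cong {f ∘ suc} {g ∘ suc} n (λ _ → f≡g (λ ()))
  = xy∙z≈zy∙x +-commutativeSemigroup (f 0) _ (g 0)
sum-applyUpTo-update (suc n) f g {suc j} (s<s j<n) f≡g
  rewrite f≡g {0} (λ ())
        | +-assoc (g 0) (sum (applyUpTo (f ∘ suc) n)) (g (suc j))
        | sum-applyUpTo-update n (f ∘ suc) (g ∘ suc) j<n (λ i≢j → f≡g (i≢j ∘ suc-injective))
  = sym (+-assoc (g 0) _ _)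

ascentBit : ℕ → ℕ → ℕ
ascentBit l w = if l <ᵇ w then 1 else 0

ascentBit-self : ∀ n → ascentBit n n ≡ 0
ascentBit-self n rewrite <ᵇ-false {n} {n} ≤-refl = refl

ascentBit-above : ∀ {l w} → l < w → ascentBit l w ≡ 1
ascentBit-above l<w rewrite <ᵇ-true l<w = refl

-- The side condition of an ascent sequence, for entries following a prefix with a ascents and last entry l.
admissibleFrom : ℕ → ℕ → List ℕ → Bool
admissibleFrom a l []       = true
admissibleFrom a l (w ∷ ws) = (w <ᵇ a + 2) ∧ admissibleFrom (a + ascentBit l w) w ws

ascFrom : ℕ → ℕ → List ℕ → ℕ
ascFrom a l []       = a
ascFrom a l (w ∷ ws) = ascFrom (a + ascentBit l w) w ws

asc-∷ʳ : ∀ r l w → asc (r ++ l ∷ w ∷ []) ≡ asc (r ++ l ∷ []) + ascentBit l w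
asc-∷ʳ []           l w = +-identityʳ _
asc-∷ʳ (x ∷ [])     l w = trans (cong (ascentBit x l +_) (asc-∷ʳ [] l w)) (sym (+-assoc (ascentBit x l) 0 _))
asc-∷ʳ (x ∷ y ∷ r) l w =
  trans (cong (ascentBit x y +_) (asc-∷ʳ (y ∷ r) l w)) (sym (+-assoc (ascentBit x y) _ (ascentBit l w)))

ascOK≡admissibleFrom : ∀ r l xs → ascOK (r ++ l ∷ []) xs ≡ admissibleFrom (asc (r ++ l ∷ [])) l xs
ascOK≡admissibleFrom r l []       = refl
ascOK≡admissibleFrom r l (w ∷ ws) = cong ((w <ᵇ asc (r ++ l ∷ []) + 2) ∧_) (begin
  ascOK ((r ++ l ∷ []) ++ w ∷ []) ws
    ≡⟨ ascOK≡admissibleFrom (r ++ l ∷ []) w ws ⟩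
  admissibleFrom (asc ((r ++ l ∷ []) ++ w ∷ [])) w ws
    ≡⟨ cong (λ a → admissibleFrom a w ws) (trans (cong asc (++-assoc r (l ∷ []) (w ∷ []))) (asc-∷ʳ r l w)) ⟩
  admissibleFrom (asc (r ++ l ∷ []) + ascentBit l w) w ws ∎)
  where open ≡-Reasoning

ascFrom≡asc : ∀ a l xs → ascFrom a l xs ≡ asc (l ∷ xs) + a
ascFrom≡asc a l []       = refl
ascFrom≡asc a l (w ∷ ws) = begin
  ascFrom (a + ascentBit l w) w ws         ≡⟨ ascFrom≡asc (a + ascentBit l w) w ws ⟩
  asc (w ∷ ws) + (a + ascentBit l w)       ≡⟨ cong (asc (w ∷ ws) +_) (+-comm a _) ⟩
  asc (w ∷ ws) + (ascentBit l w + a)       ≡⟨ +-assoc (asc (w ∷ ws)) _ a ⟨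
  asc (w ∷ ws) + ascentBit l w + a         ≡⟨ cong (_+ a) (+-comm (asc (w ∷ ws)) _) ⟩
  ascentBit l w + asc (w ∷ ws) + a         ∎
  where open ≡-Reasoning

isAscentSeq-∷ : ∀ v xs → isAscentSeq (v ∷ xs) ≡ (v ≡ᵇ 0) ∧ admissibleFrom 0 v xs
isAscentSeq-∷ v xs = cong ((v ≡ᵇ 0) ∧_) (ascOK≡admissibleFrom [] v xs)

asc-0∷ : ∀ xs → asc (0 ∷ xs) ≡ ascFrom 0 0 xs
asc-0∷ xs = sym (trans (ascFrom≡asc 0 0 xs) (+-identityʳ _))

admissibleFrom-++ˡ : ∀ a l xs ys → T (admissibleFrom a l (xs ++ ys)) → T (admissibleFrom a l xs)
admissibleFrom-++ˡ a l []       ys _   = tt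
admissibleFrom-++ˡ a l (w ∷ xs) ys adm with w<a+2 , adm-xs ← T-∧⁻ adm =
  T-∧⁺ w<a+2 (admissibleFrom-++ˡ (a + ascentBit l w) w xs ys adm-xs)

isAscentSeq-++ˡ : ∀ xs ys → T (isAscentSeq (xs ++ ys)) → T (isAscentSeq xs)
isAscentSeq-++ˡ []       ys _ = tt
isAscentSeq-++ˡ (v ∷ xs) ys h rewrite isAscentSeq-∷ v (xs ++ ys) | isAscentSeq-∷ v xs
  with v≡0 , adm ← T-∧⁻ h = T-∧⁺ v≡0 (admissibleFrom-++ˡ 0 v xs ys adm)

admissible⇒≤ : ∀ {w} a → T (w <ᵇ a + 2) → w ≤ suc a
admissible⇒≤ {w} a w<a+2 = ≤-pred (subst (suc w ≤_) (+-comm a 2) (<ᵇ⇒< w (a + 2) w<a+2))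

admissible-≤ : ∀ {u w} a → u ≤ w → T (w <ᵇ a + 2) → T (u <ᵇ a + 2)
admissible-≤ {u} {w} a u≤w w<a+2 = <⇒<ᵇ (≤-<-trans u≤w (<ᵇ⇒< w (a + 2) w<a+2))

-- Weak and strict left-to-right maxima

zeroOrWeakMax : ℕ → ℕ → Bool
zeroOrWeakMax M v = (v ≡ᵇ 0) ∨ (M ≤ᵇ v)

smallOrStrictMax : ℕ → ℕ → Bool
smallOrStrictMax M v = (v <ᵇ 2) ∨ (M <ᵇ v)

allAgainstMax : (ℕ → ℕ → Bool) → ℕ → List ℕ → Bool
allAgainstMax ok M []       = true
allAgainstMax ok M (v ∷ xs) = ok M v ∧ allAgainstMax ok (M ⊔ v) xs

ascentSeqWith : ℕ → (List ℕ → Bool) → List ℕ → Bool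
ascentSeqWith m good x = isAscentSeq x ∧ (asc x ≡ᵇ m) ∧ good x

-- Exchanging 1 with the running maximum

swapMax : ℕ → ℕ → ℕ
swapMax M v = if 1 <ᵇ M then (if v ≡ᵇ M then 1 else if v ≡ᵇ 1 then M else v) else v

swapMaxes : ℕ → List ℕ → List ℕ
swapMaxes M []       = []
swapMaxes M (v ∷ xs) = swapMax M v ∷ swapMaxes (M ⊔ v) xs

swapMax-max : ∀ {M} → 2 ≤ M → swapMax M M ≡ 1
swapMax-max {M} 2≤M rewrite <ᵇ-true 2≤M | ≡ᵇ-refl M = refl

swapMax-one : ∀ {M} → 2 ≤ M → swapMax M 1 ≡ M
swapMax-one (s≤s (s≤s z≤n)) = refl

swapMax-fixed : ∀ {M v} → (2 ≤ M → v ≢ M × v ≢ 1) → swapMax M v ≡ v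
swapMax-fixed {M} {v} moved with 1 <ᵇ M in eq
... | false = refl
... | true with moved (<ᵇ⇒< 1 M (Equivalence.from T-≡ eq))
...   | v≢M , v≢1 rewrite ≡ᵇ-false v≢M | ≡ᵇ-false v≢1 = refl

swapMax-zero : ∀ M → swapMax M 0 ≡ 0
swapMax-zero M = swapMax-fixed {M} (λ 2≤M → (λ 0≡M → m<n⇒n≢0 2≤M (sym 0≡M)) , λ ())

swapMax-above : ∀ {M w} → M < w → swapMax M w ≡ w
swapMax-above M<w = swapMax-fixed (λ 2≤M →
  (λ w≡M → <⇒≢ M<w (sym w≡M)) , (λ w≡1 → <⇒≢ (≤-trans 2≤M (<⇒≤ M<w)) (sym w≡1)))

data SwapMaxView (M : ℕ) : ℕ → Set where
  max   : 2 ≤ M → SwapMaxView M M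
  one   : 2 ≤ M → SwapMaxView M 1
  fixed : ∀ {v} → swapMax M v ≡ v → SwapMaxView M v

swapMax-view : ∀ M v → SwapMaxView M v
swapMax-view M v with 2 ≤? M
... | no M≱2 = fixed (swapMax-fixed (λ 2≤M → contradiction 2≤M M≱2))
... | yes 2≤M with v ≟ M | v ≟ 1
...   | yes refl | _        = max 2≤M
...   | no _     | yes refl = one 2≤M
...   | no v≢M   | no v≢1   = fixed (swapMax-fixed (λ _ → v≢M , v≢1))

swapMax-involutive : ∀ M v → swapMax M (swapMax M v) ≡ v
swapMax-involutive M v with swapMax-view M v
... | max 2≤M  rewrite swapMax-max 2≤M = swapMax-one 2≤M
... | one 2≤M  rewrite swapMax-one 2≤M = swapMax-max 2≤M
... | fixed eq rewrite eq = eq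

⊔-swapMax : ∀ M v → M ⊔ swapMax M v ≡ M ⊔ v
⊔-swapMax M v with swapMax-view M v
... | max 2≤M  rewrite swapMax-max 2≤M = trans (m≥n⇒m⊔n≡m (<⇒≤ 2≤M)) (sym (⊔-idem M))
... | one 2≤M  rewrite swapMax-one 2≤M = trans (⊔-idem M) (sym (m≥n⇒m⊔n≡m (<⇒≤ 2≤M)))
... | fixed eq rewrite eq = refl

swapMaxes-involutive : ∀ M xs → swapMaxes M (swapMaxes M xs) ≡ xs
swapMaxes-involutive M []       = refl
swapMaxes-involutive M (v ∷ xs) rewrite ⊔-swapMax M v =
  cong₂ _∷_ (swapMax-involutive M v) (swapMaxes-involutive (M ⊔ v) xs)

-- swapMax M is the transposition of 1 and M, both below n.
sum-applyUpTo-swapMax : ∀ (f : ℕ → ℕ) {M n} → M < n →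
  sum (applyUpTo (f ∘ swapMax M) n) ≡ sum (applyUpTo f n)
sum-applyUpTo-swapMax f {M} {n} M<n with 2 ≤? M
... | no M≱2 = sum-applyUpTo-cong n (λ _ → cong f (swapMax-fixed (λ 2≤M → contradiction 2≤M M≱2)))
sum-applyUpTo-swapMax f {suc (suc j)} {suc (suc n)} (s<s (s<s j<n)) | yes 2≤M@(s≤s (s≤s _)) =
  cong (f 0 +_) (begin
    f M + sum (applyUpTo moved n)        ≡⟨ +-comm (f M) _ ⟩
    sum (applyUpTo moved n) + f M        ≡⟨ sum-applyUpTo-update n moved shifted j<n moved≡shifted ⟩
    sum (applyUpTo shifted n) + moved j  ≡⟨ cong (λ w → sum (applyUpTo shifted n) + f w) (swapMax-max 2≤M) ⟩
    sum (applyUpTo shifted n) + f 1      ≡⟨ +-comm _ (f 1) ⟩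
    f 1 + sum (applyUpTo shifted n)      ∎)
  where
  open ≡-Reasoning
  M = suc (suc j)
  moved shifted : ℕ → ℕ
  moved i = f (swapMax M (suc (suc i)))
  shifted i = f (suc (suc i))
  moved≡shifted : ∀ {i} → i ≢ j → moved i ≡ shifted i
  moved≡shifted i≢j = cong f (swapMax-fixed (λ _ → i≢j ∘ suc-injective ∘ suc-injective , λ ()))

count-swapMaxes : ∀ (p : List ℕ → Bool) {b M} k → M < b →
  count (p ∘ swapMaxes M) (lists b k) ≡ count p (lists b k)
count-swapMaxes p         zero    M<b = refl
count-swapMaxes p {b} {M} (suc k) M<b = begin
  count (p ∘ swapMaxes M) (lists b (suc k))
    ≡⟨ count-lists-suc (p ∘ swapMaxes M) b k ⟩
  sum (applyUpTo (λ v → count (p ∘ swapMaxes M ∘ (v ∷_)) (lists b k)) b)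
    ≡⟨ sum-applyUpTo-cong b (λ {v} v<b → count-swapMaxes (p ∘ (swapMax M v ∷_)) k (⊔-lub M<b v<b)) ⟩
  sum (applyUpTo (g ∘ swapMax M) b)
    ≡⟨ sum-applyUpTo-swapMax g M<b ⟩
  sum (applyUpTo g b)
    ≡⟨ count-lists-suc p b k ⟨
  count p (lists b (suc k)) ∎
  where
  open ≡-Reasoning
  g : ℕ → ℕ
  g v = count (p ∘ (v ∷_)) (lists b k)

-- LastA M l l′: the last entries l of a sequence and l′ of its image under swapMaxes, M the largest entry so far.
data LastA (M : ℕ) : ℕ → ℕ → Set where
  zeros  : LastA M 0 0
  equal  : LastA M M M
  maxOne : 2 ≤ M → LastA M M 1

data LastB (M : ℕ) : ℕ → ℕ → Set where
  zeros  : LastB M 0 0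
  equal  : LastB M M M
  oneMax : 2 ≤ M → LastB M 1 M

LastA-≤ : ∀ {M l l′} → LastA M l l′ → l ≤ M × l′ ≤ M
LastA-≤ zeros        = z≤n , z≤n
LastA-≤ equal        = ≤-refl , ≤-refl
LastA-≤ (maxOne 2≤M) = ≤-refl , ≤-trans (s≤s z≤n) 2≤M

LastB-≤ : ∀ {M l l′} → LastB M l l′ → l ≤ M × l′ ≤ M
LastB-≤ zeros        = z≤n , z≤n
LastB-≤ equal        = ≤-refl , ≤-refl
LastB-≤ (oneMax 2≤M) = ≤-trans (s≤s z≤n) 2≤M , ≤-refl

record Step (ok : ℕ → ℕ → Bool) (Last : ℕ → ℕ → ℕ → Set) (a l l′ M w w′ : ℕ) : Set where
  field
    admissible : T (w′ <ᵇ a + 2)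
    good       : T (ok M w′)
    ascent     : ascentBit l′ w′ ≡ ascentBit l w
    last       : Last (M ⊔ w) w w′

step-above : ∀ {ok Last a l l′ M w} → (∀ {N} → Last N N N) → l ≤ M → l′ ≤ M → M < w →
  T (w <ᵇ a + 2) → T (ok M w) → Step ok Last a l l′ M w (swapMax M w)
step-above {Last = Last} {M = M} {w} diagonal l≤M l′≤M M<w adm ok-w rewrite swapMax-above M<w = record
  { admissible = adm
  ; good       = ok-w
  ; ascent     = trans (ascentBit-above (≤-<-trans l′≤M M<w)) (sym (ascentBit-above (≤-<-trans l≤M M<w)))
  ; last       = subst (λ N → Last N w w) (sym (m≤n⇒m⊔n≡n (<⇒≤ M<w))) diagonal
  }

stepA-repeat : ∀ {a l l′ M} → 1 ≤ M → LastA M l l′ → T (M <ᵇ a + 2) →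
  Step smallOrStrictMax LastA a l l′ M M (swapMax M M)
stepA-repeat {M = 1} _ zeros adm = record { admissible = adm ; good = tt ; ascent = refl ; last = equal }
stepA-repeat {M = 1} _ equal adm = record { admissible = adm ; good = tt ; ascent = refl ; last = equal }
stepA-repeat {M = 1} _ (maxOne (s≤s ())) _
stepA-repeat {a} {M = M@(suc (suc k))} _ last adm rewrite swapMax-max {M} (s≤s (s≤s z≤n)) = record
  { admissible = admissible-≤ a (s≤s z≤n) adm
  ; good       = tt
  ; ascent     = ascent last
  ; last       = subst (λ N → LastA N M 1) (sym (⊔-idem M)) (maxOne (s≤s (s≤s z≤n)))
  }
  where
  ascent : ∀ {l l′} → LastA M l l′ → ascentBit l′ 1 ≡ ascentBit l M
  ascent zeros      = refl
  ascent equal      = sym (ascentBit-self M)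
  ascent (maxOne _) = sym (ascentBit-self M)

stepA : ∀ {a l l′ M w} → LastA M l l′ → M < a + 2 → T (w <ᵇ a + 2) → T (zeroOrWeakMax M w) →
  Step smallOrStrictMax LastA a l l′ M w (swapMax M w)
stepA {M = M} {zero} _ _ adm _ rewrite swapMax-zero M =
  record { admissible = adm ; good = tt ; ascent = refl ; last = zeros }
stepA {M = M} {suc v} last _ adm ok-w with m≤n⇒m<n∨m≡n (≤ᵇ⇒≤ M (suc v) ok-w)
... | inj₁ M<w = step-above equal (proj₁ (LastA-≤ last)) (proj₂ (LastA-≤ last)) M<w adm (T-∨⁺ʳ (<⇒<ᵇ M<w))
... | inj₂ refl = stepA-repeat (s≤s z≤n) last adm

stepB-one : ∀ {a l l′ M} → LastB M l l′ → M < a + 2 → T (1 <ᵇ a + 2) →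
  Step zeroOrWeakMax LastB a l l′ M 1 (swapMax M 1)
stepB-one {M = 0} zeros _ adm = record { admissible = adm ; good = tt ; ascent = refl ; last = equal }
stepB-one {M = 0} equal _ adm = record { admissible = adm ; good = tt ; ascent = refl ; last = equal }
stepB-one {M = 1} zeros _ adm = record { admissible = adm ; good = tt ; ascent = refl ; last = equal }
stepB-one {M = 1} equal _ adm = record { admissible = adm ; good = tt ; ascent = refl ; last = equal }
stepB-one {M = 1} (oneMax (s≤s ())) _ _
stepB-one {M = M@(suc (suc k))} last M<a+2 _ = record
  { admissible = <⇒<ᵇ M<a+2
  ; good       = T-∨⁺ʳ (≤⇒≤ᵇ (≤-refl {M}))
  ; ascent     = ascent last
  ; last       = oneMax (s≤s (s≤s z≤n))
  }
  where
  ascent : ∀ {l l′} → LastB M l l′ → ascentBit l′ M ≡ ascentBit l 1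
  ascent zeros      = refl
  ascent equal      = ascentBit-self M
  ascent (oneMax _) = ascentBit-self M

stepB : ∀ {a l l′ M w} → LastB M l l′ → M < a + 2 → T (w <ᵇ a + 2) → T (smallOrStrictMax M w) →
  Step zeroOrWeakMax LastB a l l′ M w (swapMax M w)
stepB {M = M} {zero} _ _ adm _ rewrite swapMax-zero M =
  record { admissible = adm ; good = tt ; ascent = refl ; last = zeros }
stepB {w = 1} last M<a+2 adm _ = stepB-one last M<a+2 adm
stepB {M = M} {suc (suc v)} last _ adm ok-w = step-above equal (proj₁ (LastB-≤ last)) (proj₂ (LastB-≤ last))
  (<ᵇ⇒< M (suc (suc v)) ok-w) adm (T-∨⁺ʳ (≤⇒≤ᵇ (<⇒≤ (<ᵇ⇒< M (suc (suc v)) ok-w))))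

-- M < a + 2 holds along every ascent sequence; it is what allows M to be written in place of 1.
StepLemma : (ℕ → ℕ → Bool) → (ℕ → ℕ → Bool) → (ℕ → ℕ → ℕ → Set) → Set
StepLemma okFrom okTo Last = ∀ {a l l′ M w} → Last M l l′ → M < a + 2 → T (w <ᵇ a + 2) → T (okFrom M w) →
  Step okTo Last a l l′ M w (swapMax M w)

⊔-<-+ : ∀ {M w} a b → M < a + 2 → w < a + 2 → M ⊔ w < a + b + 2
⊔-<-+ a b M< w< = ≤-trans (⊔-lub M< w<) (+-monoˡ-≤ 2 (m≤m+n a b))

swapMaxes-transfers : ∀ {okFrom okTo Last} → StepLemma okFrom okTo Last →
  ∀ {a l l′ M} xs → Last M l l′ → M < a + 2 → T (admissibleFrom a l xs) → T (allAgainstMax okFrom M xs) →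
  T (admissibleFrom a l′ (swapMaxes M xs)) × T (allAgainstMax okTo M (swapMaxes M xs))
    × ascFrom a l′ (swapMaxes M xs) ≡ ascFrom a l xs
swapMaxes-transfers step []       _    _     _   _    = tt , tt , refl
swapMaxes-transfers step {a} {l} {l′} {M} (w ∷ ws) last M<a+2 adm good
  with adm-w , adm-ws ← T-∧⁻ adm | good-w , good-ws ← T-∧⁻ good
  with s ← step last M<a+2 adm-w good-w
  rewrite Step.ascent s | ⊔-swapMax M w
  with adm′ , good′ , asc′ ←
         swapMaxes-transfers step ws (Step.last s) (⊔-<-+ a (ascentBit l w) M<a+2 (<ᵇ⇒< w (a + 2) adm-w))
           adm-ws good-ws
  = T-∧⁺ (Step.admissible s) adm′ , T-∧⁺ (Step.good s) good′ , asc′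

ascentSeqWith-0∷ : ∀ m g xs →
  ascentSeqWith m g (0 ∷ xs) ≡ admissibleFrom 0 0 (0 ∷ xs) ∧ (ascFrom 0 0 (0 ∷ xs) ≡ᵇ m) ∧ g (0 ∷ xs)
ascentSeqWith-0∷ m g xs rewrite isAscentSeq-∷ 0 xs | asc-0∷ xs = refl

ascentSeqWith-swapMaxes : ∀ {okFrom okTo Last} → StepLemma okFrom okTo Last → Last 0 0 0 → ∀ m x →
  T (ascentSeqWith m (allAgainstMax okFrom 0) x) → T (ascentSeqWith m (allAgainstMax okTo 0) (swapMaxes 0 x))
ascentSeqWith-swapMaxes step init m []          h = h
ascentSeqWith-swapMaxes step init m (suc _ ∷ _) ()
ascentSeqWith-swapMaxes {okFrom} {okTo} step init m (0 ∷ xs) h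
  rewrite ascentSeqWith-0∷ m (allAgainstMax okFrom 0) xs
        | ascentSeqWith-0∷ m (allAgainstMax okTo 0) (swapMaxes 0 xs)
  with adm , rest ← T-∧⁻ h
  with asc≡m , good ← T-∧⁻ rest
  with adm′ , good′ , asc′ ← swapMaxes-transfers step {0} {0} {0} {0} (0 ∷ xs) init (s≤s z≤n) adm good
  = T-∧⁺ adm′ (T-∧⁺ (subst (λ k → T (k ≡ᵇ m)) (sym asc′) asc≡m) good′)

weakMaximaCount strictMaximaCount : ℕ → ℕ → ℕ
weakMaximaCount   n m = count (ascentSeqWith m (allAgainstMax zeroOrWeakMax 0)) (lists n n)
strictMaximaCount n m = count (ascentSeqWith m (allAgainstMax smallOrStrictMax 0)) (lists n n)

weakMaximaCount≡strictMaximaCount : ∀ m {n} → 0 < n → weakMaximaCount n m ≡ strictMaximaCount n m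
weakMaximaCount≡strictMaximaCount m {n} 0<n =
  trans (count-cong (λ x → T-ext (A→B x) (B→A x)) (lists n n)) (count-swapMaxes classB n 0<n)
  where
  classA classB : List ℕ → Bool
  classA = ascentSeqWith m (allAgainstMax zeroOrWeakMax 0)
  classB = ascentSeqWith m (allAgainstMax smallOrStrictMax 0)
  A→B : ∀ x → T (classA x) → T (classB (swapMaxes 0 x))
  A→B = ascentSeqWith-swapMaxes stepA zeros m
  B→A : ∀ x → T (classB (swapMaxes 0 x)) → T (classA x)
  B→A x h =
    subst (T ∘ classA) (swapMaxes-involutive 0 x) (ascentSeqWith-swapMaxes stepB zeros m (swapMaxes 0 x) h)

∈-subseqs⁻ : ∀ k x {ρ} → ρ ∈ subseqs k x → ρ ⊆ x
∈-subseqs⁻ zero    x        (here refl) = minimum x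
∈-subseqs⁻ (suc k) (y ∷ ys) ρ∈ with ∈-++⁻ (map (y ∷_) (subseqs k ys)) ρ∈
... | inj₁ ρ∈map with _ , ρ′∈ , refl ← ∈-map⁻ (y ∷_) ρ∈map = refl ∷ ∈-subseqs⁻ k ys ρ′∈
... | inj₂ ρ∈rest = y ∷ʳ ∈-subseqs⁻ (suc k) ys ρ∈rest

∈-subseqs⁺ : ∀ {ρ x} → ρ ⊆ x → ρ ∈ subseqs (length ρ) x
∈-subseqs⁺ []                      = here refl
∈-subseqs⁺ {[]}    (y ∷ʳ ρ⊆ys)     = here refl
∈-subseqs⁺ {r ∷ ρ} (y ∷ʳ ρ⊆ys)     = ∈-++⁺ʳ (map (y ∷_) (subseqs (length ρ) _)) (∈-subseqs⁺ ρ⊆ys)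
∈-subseqs⁺ {r ∷ ρ} (refl ∷ ρ⊆ys)   = ∈-++⁺ˡ (∈-map⁺ (r ∷_) (∈-subseqs⁺ ρ⊆ys))

orderIso-length : ∀ {ρ τ} → T (orderIso ρ τ) → length ρ ≡ length τ
orderIso-length {ρ} {τ} o = ≡ᵇ⇒≡ (length ρ) (length τ) (proj₁ (T-∧⁻ o))

contains-intro : ∀ {ρ x} τ → ρ ⊆ x → T (orderIso ρ τ) → T (contains x τ)
contains-intro {ρ} {x} τ ρ⊆x o = any⁺ (λ r → orderIso r τ)
  (lose (subst (λ k → ρ ∈ subseqs k x) (orderIso-length {ρ} {τ} o) (∈-subseqs⁺ ρ⊆x)) o)

contains-elim : ∀ {x τ} → T (contains x τ) → ∃ λ ρ → ρ ⊆ x × T (orderIso ρ τ)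
contains-elim {x} {τ} c with ρ , ρ∈ , o ← find (any⁻ (λ r → orderIso r τ) (subseqs (length τ) x) c) =
  ρ , ∈-subseqs⁻ (length τ) x ρ∈ , o

≡ᴮ⇒≡ : ∀ {a b} → T (a ≡ᴮ b) → a ≡ b
≡ᴮ⇒≡ {true}  {true}  _ = refl
≡ᴮ⇒≡ {false} {false} _ = refl

≡ᴮ-refl : ∀ b → T (b ≡ᴮ b)
≡ᴮ-refl true  = tt
≡ᴮ-refl false = tt

orderIso-<ᵇ : ∀ {ρ τ x i y j} → T (orderIso ρ τ) → (x , i) ∈ zipP ρ τ → (y , j) ∈ zipP ρ τ →
  (x <ᵇ y) ≡ (i <ᵇ j)
orderIso-<ᵇ o xi∈ yj∈ =
  ≡ᴮ⇒≡ (proj₁ (T-∧⁻ (All.lookup (all⁺ _ _ (All.lookup (all⁺ _ _ (proj₂ (T-∧⁻ o))) xi∈)) yj∈)))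

module Occurrence {a₀ a₁ a₂ a₃ t₀ t₁ t₂ t₃ : ℕ}
         (o : T (orderIso (a₀ ∷ a₁ ∷ a₂ ∷ a₃ ∷ []) (t₀ ∷ t₁ ∷ t₂ ∷ t₃ ∷ []))) where

  private
    ρ τ : List ℕ
    ρ = a₀ ∷ a₁ ∷ a₂ ∷ a₃ ∷ []
    τ = t₀ ∷ t₁ ∷ t₂ ∷ t₃ ∷ []

    at : ∀ i → (lookup ρ i , lookup τ i) ∈ zipP ρ τ
    at Fin.zero                               = here refl
    at (Fin.suc Fin.zero)                     = there (here refl)
    at (Fin.suc (Fin.suc Fin.zero))           = there (there (here refl))
    at (Fin.suc (Fin.suc (Fin.suc Fin.zero))) = there (there (there (here refl)))

  <-at : ∀ i j → T (lookup τ i <ᵇ lookup τ j) → lookup ρ i < lookup ρ j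
  <-at i j t = <ᵇ⇒< _ _ (subst T (sym (orderIso-<ᵇ {ρ} {τ} o (at i) (at j))) t)

  ≤-at : ∀ i j → ¬ T (lookup τ j <ᵇ lookup τ i) → lookup ρ i ≤ lookup ρ j
  ≤-at i j ¬t = ≮⇒≥ (¬t ∘ subst T (orderIso-<ᵇ {ρ} {τ} o (at j) (at i)) ∘ <⇒<ᵇ)

<ᵇ-preserved : ∀ {f : ℕ → ℕ} {i j} → (i < j → f i < f j) → (j < i → f j < f i) → (f i <ᵇ f j) ≡ (i <ᵇ j)
<ᵇ-preserved {f} {i} {j} mono mono′ with <-cmp i j
... | tri< i<j _ _    = trans (<ᵇ-true (mono i<j)) (sym (<ᵇ-true i<j))
... | tri≈ _ refl _   = trans (<ᵇ-false {f i} ≤-refl) (sym (<ᵇ-false {i} ≤-refl))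
... | tri> _ _ j<i    = trans (<ᵇ-false (<⇒≤ (mono′ j<i))) (sym (<ᵇ-false (<⇒≤ j<i)))

zipP-map : ∀ (f : ℕ → ℕ) τ → zipP (map f τ) τ ≡ map (λ i → f i , i) τ
zipP-map f []      = refl
zipP-map f (i ∷ τ) = cong ((f i , i) ∷_) (zipP-map f τ)

orderIso-map : ∀ (f : ℕ → ℕ) τ → (∀ {i j} → i ∈ τ → j ∈ τ → i < j → f i < f j) → T (orderIso (map f τ) τ)
orderIso-map f τ mono rewrite length-map f τ | zipP-map f τ =
  T-∧⁺ (≡⇒≡ᵇ (length τ) (length τ) refl)
       (all⁻ _ (All-map⁺ (All.tabulate λ i∈ → all⁻ _ (All-map⁺ (All.tabulate λ j∈ → agree i∈ j∈)))))
  where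
  agree : ∀ {i j} → i ∈ τ → j ∈ τ → T (((f i <ᵇ f j) ≡ᴮ (i <ᵇ j)) ∧ ((f j <ᵇ f i) ≡ᴮ (j <ᵇ i)))
  agree {i} {j} i∈ j∈
    rewrite <ᵇ-preserved {f} (mono i∈ j∈) (mono j∈ i∈) | <ᵇ-preserved {f} (mono j∈ i∈) (mono i∈ j∈) =
    T-∧⁺ (≡ᴮ-refl (i <ᵇ j)) (≡ᴮ-refl (j <ᵇ i))

valuation : ℕ → ℕ → ℕ → ℕ → ℕ → ℕ
valuation w₀ w₁ w₂ w₃ 0 = w₀
valuation w₀ w₁ w₂ w₃ 1 = w₁
valuation w₀ w₁ w₂ w₃ 2 = w₂
valuation w₀ w₁ w₂ w₃ _ = w₃

module _ {w₀ w₁ w₂ w₃ : ℕ} (w₀<w₁ : w₀ < w₁) (w₁<w₂ : w₁ < w₂) (w₂<w₃ : w₂ < w₃) where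

  private
    f = valuation w₀ w₁ w₂ w₃

    f-suc : ∀ {i} → i < 3 → f i < f (suc i)
    f-suc {0} _ = w₀<w₁
    f-suc {1} _ = w₁<w₂
    f-suc {2} _ = w₂<w₃
    f-suc {suc (suc (suc _))} (s≤s (s≤s (s≤s ())))

    f-mono : ∀ {i j} → i < j → j ≤ 3 → f i < f j
    f-mono {i} {suc j} i<j+1 j<3 with m≤n⇒m<n∨m≡n (≤-pred i<j+1)
    ... | inj₁ i<j  = <-trans (f-mono i<j (<⇒≤ j<3)) (f-suc j<3)
    ... | inj₂ refl = f-suc j<3

  contains-valuation : ∀ τ {_ : True (all? (_≤? 3) τ)} {x} → map f τ ⊆ x → T (contains x τ)
  contains-valuation τ {letters≤3} fτ⊆x = contains-intro τ fτ⊆x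
    (orderIso-map f τ (λ _ j∈ i<j → f-mono i<j (All.lookup (toWitness letters≤3) j∈)))

contains-0121 : ∀ {x p q} → 0 < p → p < q → (0 ∷ p ∷ q ∷ p ∷ []) ⊆ x → T (contains x (0 ∷ 1 ∷ 2 ∷ 1 ∷ []))
contains-0121 {q = q} 0<p p<q = contains-valuation 0<p p<q (n<1+n q) (0 ∷ 1 ∷ 2 ∷ 1 ∷ [])

contains-0122 : ∀ {x p q} → 0 < p → p < q → (0 ∷ p ∷ q ∷ q ∷ []) ⊆ x → T (contains x (0 ∷ 1 ∷ 2 ∷ 2 ∷ []))
contains-0122 {q = q} 0<p p<q = contains-valuation 0<p p<q (n<1+n q) (0 ∷ 1 ∷ 2 ∷ 2 ∷ [])

ForcedByDescent : List ℕ → Set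
ForcedByDescent τ = ∀ {x y z v c} → z < y → y < v → v < c → (0 ∷ y ∷ z ∷ c ∷ v ∷ []) ⊆ x → T (contains x τ)

forced-0132 : ForcedByDescent (0 ∷ 1 ∷ 3 ∷ 2 ∷ [])
forced-0132 {z = z} z<y y<v v<c sub =
  contains-valuation (≤-<-trans z≤n z<y) y<v v<c (0 ∷ 1 ∷ 3 ∷ 2 ∷ [])
    (⊆-trans (refl ∷ refl ∷ z ∷ʳ ⊆-refl) sub)

forced-1032 : ForcedByDescent (1 ∷ 0 ∷ 3 ∷ 2 ∷ [])
forced-1032 z<y y<v v<c sub = contains-valuation z<y y<v v<c (1 ∷ 0 ∷ 3 ∷ 2 ∷ []) (⊆-trans (0 ∷ʳ ⊆-refl) sub)

-- The classes avoid the patterns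

Antitone : (ℕ → ℕ → Bool) → Set
Antitone ok = ∀ {M M′} v → M ≤ M′ → T (ok M′ v) → T (ok M v)

zeroOrWeakMax-antitone : Antitone zeroOrWeakMax
zeroOrWeakMax-antitone {M} {M′} v M≤M′ h =
  Equivalence.from T-∨ (map₂ (λ M′≤v → ≤⇒≤ᵇ (≤-trans M≤M′ (≤ᵇ⇒≤ M′ v M′≤v))) (T-∨⁻ {v ≡ᵇ 0} h))

smallOrStrictMax-antitone : Antitone smallOrStrictMax
smallOrStrictMax-antitone {M} {M′} v M≤M′ h =
  Equivalence.from T-∨ (map₂ (λ M′<v → <⇒<ᵇ (≤-<-trans M≤M′ (<ᵇ⇒< M′ v M′<v))) (T-∨⁻ {v <ᵇ 2} h))

allAgainstMax-∈ : ∀ {ok} → Antitone ok → ∀ {M xs v} → T (allAgainstMax ok M xs) → v ∈ xs → T (ok M v)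
allAgainstMax-∈ anti h (here refl) = proj₁ (T-∧⁻ h)
allAgainstMax-∈ anti {M} {w ∷ _} {v} h (there v∈) =
  anti v (m≤m⊔n M w) (allAgainstMax-∈ anti (proj₂ (T-∧⁻ h)) v∈)

allAgainstMax-pair : ∀ {ok} → Antitone ok → ∀ {M xs c d} → T (allAgainstMax ok M xs) →
  (c ∷ d ∷ []) ⊆ xs → T (ok c d)
allAgainstMax-pair anti h (_ ∷ʳ cd⊆) = allAgainstMax-pair anti (proj₂ (T-∧⁻ h)) cd⊆
allAgainstMax-pair anti {M} {c ∷ _} {d = d} h (refl ∷ d⊆) =
  anti d (m≤n⊔m M c) (allAgainstMax-∈ anti (proj₂ (T-∧⁻ h)) (to∈ d⊆))

data Four : List ℕ → Set where
  four : ∀ a b c d → Four (a ∷ b ∷ c ∷ d ∷ [])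

four? : ∀ ρ → length ρ ≡ 4 → Four ρ
four? (a ∷ b ∷ c ∷ d ∷ []) _ = four a b c d

Violates : (ℕ → ℕ → Bool) → List ℕ → Set
Violates ok τ = ∀ a b c d → T (orderIso (a ∷ b ∷ c ∷ d ∷ []) τ) → ¬ T (ok c d)

allAgainstMax-avoids : ∀ {ok τ M x} → Antitone ok → Violates ok τ → length τ ≡ 4 →
  T (allAgainstMax ok M x) → ¬ T (contains x τ)
allAgainstMax-avoids {τ = τ} anti violates ∣τ∣≡4 h τ⊑x with ρ , ρ⊆x , o ← contains-elim τ⊑x
  with four a b c d ← four? ρ (trans (orderIso-length {ρ} {τ} o) ∣τ∣≡4) =
  violates a b c d o (allAgainstMax-pair anti h (⊆-trans (a ∷ʳ b ∷ʳ ⊆-refl) ρ⊆x))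

zeroOrWeakMax-¬⁺ : ∀ {c d} → 0 < d → d < c → ¬ T (zeroOrWeakMax c d)
zeroOrWeakMax-¬⁺ {c} {suc d} (s≤s z≤n) d<c c≤d = <⇒≱ d<c (≤ᵇ⇒≤ c (suc d) c≤d)

smallOrStrictMax-¬⁺ : ∀ {c d} → 2 ≤ d → d ≤ c → ¬ T (smallOrStrictMax c d)
smallOrStrictMax-¬⁺ {c} {suc (suc d)} (s≤s (s≤s z≤n)) d≤c c<d = <⇒≱ (<ᵇ⇒< c (suc (suc d)) c<d) d≤c

<-<⇒2≤ : ∀ {x y d} → x < y → y < d → 2 ≤ d
<-<⇒2≤ x<y y<d = ≤-trans (s≤s (≤-<-trans z≤n x<y)) y<d

violatesWeak-0121 : Violates zeroOrWeakMax (0 ∷ 1 ∷ 2 ∷ 1 ∷ [])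
violatesWeak-0121 a b c d o = zeroOrWeakMax-¬⁺ (≤-<-trans z≤n (<-at (# 0) (# 3) tt)) (<-at (# 3) (# 2) tt)
  where open Occurrence {a} {b} {c} {d} {0} {1} {2} {1} o

violatesWeak-0132 : Violates zeroOrWeakMax (0 ∷ 1 ∷ 3 ∷ 2 ∷ [])
violatesWeak-0132 a b c d o = zeroOrWeakMax-¬⁺ (≤-<-trans z≤n (<-at (# 0) (# 3) tt)) (<-at (# 3) (# 2) tt)
  where open Occurrence {a} {b} {c} {d} {0} {1} {3} {2} o

violatesWeak-1032 : Violates zeroOrWeakMax (1 ∷ 0 ∷ 3 ∷ 2 ∷ [])
violatesWeak-1032 a b c d o = zeroOrWeakMax-¬⁺ (≤-<-trans z≤n (<-at (# 1) (# 3) tt)) (<-at (# 3) (# 2) tt)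
  where open Occurrence {a} {b} {c} {d} {1} {0} {3} {2} o

violatesStrict-0122 : Violates smallOrStrictMax (0 ∷ 1 ∷ 2 ∷ 2 ∷ [])
violatesStrict-0122 a b c d o =
  smallOrStrictMax-¬⁺ (<-<⇒2≤ (<-at (# 0) (# 1) tt) (<-at (# 1) (# 3) tt)) (≤-at (# 3) (# 2) (λ ()))
  where open Occurrence {a} {b} {c} {d} {0} {1} {2} {2} o

violatesStrict-0132 : Violates smallOrStrictMax (0 ∷ 1 ∷ 3 ∷ 2 ∷ [])
violatesStrict-0132 a b c d o =
  smallOrStrictMax-¬⁺ (<-<⇒2≤ (<-at (# 0) (# 1) tt) (<-at (# 1) (# 3) tt)) (≤-at (# 3) (# 2) (λ ()))
  where open Occurrence {a} {b} {c} {d} {0} {1} {3} {2} o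

violatesStrict-1032 : Violates smallOrStrictMax (1 ∷ 0 ∷ 3 ∷ 2 ∷ [])
violatesStrict-1032 a b c d o =
  smallOrStrictMax-¬⁺ (<-<⇒2≤ (<-at (# 1) (# 0) tt) (<-at (# 0) (# 3) tt)) (≤-at (# 3) (# 2) (λ ()))
  where open Occurrence {a} {b} {c} {d} {1} {0} {3} {2} o

-- Sequences outside the classes contain the patterns

FirstExceeding : ℕ → List ℕ → Set
FirstExceeding s ys = ∃ λ c → s < c ×
  ((∃₂ λ y z → z < y × y ≤ s × (0 ∷ y ∷ z ∷ c ∷ []) ⊆ ys) ⊎ (c ≡ suc s × (0 ∷ s ∷ c ∷ []) ⊆ ys))

-- What has been read of 0 ∷ q, which has a ascents and ends in l ≤ s: either a descent below s + 1,
-- or, failing that, the entries so far are weakly increasing, so a ≤ l.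
ScanInvariant : ℕ → List ℕ → ℕ → ℕ → Set
ScanInvariant s q a l =
  (∃₂ λ y z → z < y × y ≤ s × (0 ∷ y ∷ z ∷ []) ⊆ 0 ∷ q) ⊎ (a ≤ l × (1 ≤ l → (0 ∷ l ∷ []) ⊆ 0 ∷ q))

ascentBit-bound : ∀ {a l w} → a ≤ l → l ≤ w → a + ascentBit l w ≤ w
ascentBit-bound {a} {l} {w} a≤l l≤w with m≤n⇒m<n∨m≡n l≤w
... | inj₁ l<w  rewrite ascentBit-above l<w = subst (_≤ w) (+-comm 1 a) (≤-<-trans a≤l l<w)
... | inj₂ refl rewrite ascentBit-self l    = subst (_≤ l) (sym (+-identityʳ a)) a≤l

scanInvariant-step : ∀ {s q a l w} → l ≤ s → w ≤ s → ScanInvariant s q a l →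
  ScanInvariant s (q ++ w ∷ []) (a + ascentBit l w) w
scanInvariant-step {w = w} _ _ (inj₁ (y , z , z<y , y≤s , sub)) = inj₁ (y , z , z<y , y≤s , ++⁺ʳ (w ∷ []) sub)
scanInvariant-step {q = q} {l = l} {w} l≤s _ (inj₂ (a≤l , sub)) with w <? l
... | yes w<l = inj₁ (l , w , w<l , l≤s , ++⁺ (sub (≤-<-trans z≤n w<l)) (refl ∷ []))
... | no  w≮l = inj₂ (ascentBit-bound a≤l (≮⇒≥ w≮l) , λ _ → refl ∷ ++⁺ˡ q (refl ∷ []))

-- Without a descent, the entry w > s satisfies w ≤ a + 1 ≤ l + 1 ≤ s + 1, hence w = s + 1 and l = s.
scan-found : ∀ {s q a l w} ws → 1 ≤ s → l ≤ s → T (w <ᵇ a + 2) → s < w → ScanInvariant s q a l →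
  FirstExceeding s (0 ∷ q ++ w ∷ ws)
scan-found {w = w} ws _ _ _ s<w (inj₁ (y , z , z<y , y≤s , sub)) =
  w , s<w , inj₁ (y , z , z<y , y≤s , ++⁺ sub (refl ∷ minimum ws))
scan-found {s} {a = a} {l} {w} ws 1≤s l≤s adm s<w (inj₂ (a≤l , sub))
  with refl ← ≤-antisym (≤-trans (admissible⇒≤ a adm) (s≤s (≤-trans a≤l l≤s))) s<w
  with refl ← ≤-antisym l≤s (≤-trans (≤-pred (admissible⇒≤ a adm)) a≤l) =
  suc s , ≤-refl , inj₂ (refl , ++⁺ (sub 1≤s) (refl ∷ minimum ws))

scan : ∀ {s} → 1 ≤ s → ∀ q {a l} ws → l ≤ s → ScanInvariant s q a l → T (admissibleFrom a l ws) →
  Any (s <_) ws → FirstExceeding s (0 ∷ q ++ ws)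
scan {s} 1≤s q (w ∷ ws) l≤s inv adm exceeds with adm-w , adm-ws ← T-∧⁻ adm | s <? w
... | yes s<w = scan-found ws 1≤s l≤s adm-w s<w inv
... | no  s≮w = subst (FirstExceeding s ∘ (0 ∷_)) (++-assoc q (w ∷ []) ws)
  (scan 1≤s (q ++ w ∷ []) ws (≮⇒≥ s≮w) (scanInvariant-step l≤s (≮⇒≥ s≮w) inv) adm-ws (Any.tail s≮w exceeds))

firstExceeding : ∀ {s pre} → 1 ≤ s → T (isAscentSeq pre) → Any (s <_) pre → FirstExceeding s pre
firstExceeding {pre = zero ∷ q} 1≤s seq exceeds =
  scan 1≤s [] q z≤n (inj₂ (z≤n , λ ())) (subst T (isAscentSeq-∷ 0 q) seq) (Any.tail (λ ()) exceeds)
firstExceeding {pre = suc _ ∷ _} _ () _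

data Splits (P : List ℕ → ℕ → Set) : List ℕ → Set where
  split : ∀ pre v rest → P pre v → Splits P (pre ++ v ∷ rest)

allAgainstMax-violation : ∀ ok M xs → ¬ T (allAgainstMax ok M xs) →
  Splits (λ pre v → ∃ λ c → (c ≡ M ⊎ c ∈ pre) × ¬ T (ok c v)) xs
allAgainstMax-violation ok M []       h = contradiction tt h
allAgainstMax-violation ok M (w ∷ ws) h with T? (ok M w)
... | no ¬ok = split [] w ws (M , inj₁ refl , ¬ok)
... | yes ok-w with allAgainstMax-violation ok (M ⊔ w) ws (h ∘ T-∧⁺ ok-w)
...   | split pre v rest (c , inj₂ c∈pre   , ¬ok) = split (w ∷ pre) v rest (c , inj₂ (there c∈pre) , ¬ok)
...   | split pre v rest (c , inj₁ c≡M⊔w , ¬ok) =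
  split (w ∷ pre) v rest (c , Sum.map (trans c≡M⊔w) (here ∘ trans c≡M⊔w) (⊔-sel M w) , ¬ok)

zeroOrWeakMax-¬⁻ : ∀ {c d} → ¬ T (zeroOrWeakMax c d) → 0 < d × d < c
zeroOrWeakMax-¬⁻ {c} {zero}  ¬ok = contradiction tt ¬ok
zeroOrWeakMax-¬⁻ {c} {suc d} ¬ok = s≤s z≤n , ≰⇒> (¬ok ∘ ≤⇒≤ᵇ)

smallOrStrictMax-¬⁻ : ∀ {c d} → ¬ T (smallOrStrictMax c d) → 2 ≤ d × d ≤ c
smallOrStrictMax-¬⁻ {c} {0}           ¬ok = contradiction tt ¬ok
smallOrStrictMax-¬⁻ {c} {1}           ¬ok = contradiction tt ¬ok
smallOrStrictMax-¬⁻ {c} {suc (suc d)} ¬ok = s≤s (s≤s z≤n) , ≮⇒≥ (¬ok ∘ <⇒<ᵇ)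

weakMaxima-violation : ∀ x → ¬ T (allAgainstMax zeroOrWeakMax 0 x) →
  Splits (λ pre v → 0 < v × Any (v <_) pre) x
weakMaxima-violation x h with allAgainstMax-violation zeroOrWeakMax 0 x h
... | split pre v rest (c , inj₂ c∈pre , ¬ok) =
  split pre v rest (Product.map₂ (lose c∈pre) (zeroOrWeakMax-¬⁻ {c} {v} ¬ok))
... | split pre v rest (_ , inj₁ refl  , ¬ok) = contradiction (proj₂ (zeroOrWeakMax-¬⁻ {0} {v} ¬ok)) λ ()

strictMaxima-violation : ∀ x → ¬ T (allAgainstMax smallOrStrictMax 0 x) →
  Splits (λ pre v → 2 ≤ v × Any (v ≤_) pre) x
strictMaxima-violation x h with allAgainstMax-violation smallOrStrictMax 0 x h
... | split pre v rest (c , inj₂ c∈pre , ¬ok) =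
  split pre v rest (Product.map₂ (lose c∈pre) (smallOrStrictMax-¬⁻ {c} {v} ¬ok))
... | split pre v rest (_ , inj₁ refl  , ¬ok) with 2≤v , v≤0 ← smallOrStrictMax-¬⁻ {0} {v} ¬ok =
  contradiction (≤-trans 2≤v v≤0) λ ()

⊆-extend : ∀ {ρ pre : List ℕ} v rest → ρ ⊆ pre → (ρ ++ v ∷ []) ⊆ pre ++ v ∷ rest
⊆-extend v rest ρ⊆pre = ++⁺ ρ⊆pre (refl ∷ minimum rest)

weakMaxima-violation⇒contains : ∀ {τ x} → ForcedByDescent τ → T (isAscentSeq x) →
  ¬ T (allAgainstMax zeroOrWeakMax 0 x) → T (contains x (0 ∷ 1 ∷ 2 ∷ 1 ∷ [])) ⊎ T (contains x τ)
weakMaxima-violation⇒contains {x = x} forced seq h with weakMaxima-violation x h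
... | split pre v rest (1≤v , exceeds)
  with firstExceeding {v} {pre} 1≤v (isAscentSeq-++ˡ pre (v ∷ rest) seq) exceeds
...   | c , v<c , inj₂ (refl , sub) = inj₁ (contains-0121 1≤v v<c (⊆-extend v rest sub))
...   | c , v<c , inj₁ (y , z , z<y , y≤v , sub) with m≤n⇒m<n∨m≡n y≤v
...     | inj₂ refl = inj₁ (contains-0121 1≤v v<c (⊆-extend v rest (⊆-trans (refl ∷ refl ∷ z ∷ʳ ⊆-refl) sub)))
...     | inj₁ y<v  = inj₂ (forced z<y y<v v<c (⊆-extend v rest sub))

strictMaxima-violation⇒contains : ∀ {τ x} → ForcedByDescent τ → T (isAscentSeq x) →
  ¬ T (allAgainstMax smallOrStrictMax 0 x) → T (contains x (0 ∷ 1 ∷ 2 ∷ 2 ∷ [])) ⊎ T (contains x τ)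
strictMaxima-violation⇒contains {x = x} forced seq h with strictMaxima-violation x h
... | split pre (suc s) rest (s≤s 1≤s , exceeds)
  with firstExceeding {s} {pre} 1≤s (isAscentSeq-++ˡ pre (suc s ∷ rest) seq) exceeds
...   | c , s<c , inj₂ (refl , sub) = inj₁ (contains-0122 1≤s ≤-refl (⊆-extend (suc s) rest sub))
...   | c , s<c , inj₁ (y , z , z<y , y≤s , sub) with m≤n⇒m<n∨m≡n s<c
...     | inj₂ refl = inj₁ (contains-0122 (≤-<-trans z≤n z<y) (s≤s y≤s)
                              (⊆-extend (suc s) rest (⊆-trans (refl ∷ refl ∷ z ∷ʳ ⊆-refl) sub)))
...     | inj₁ v<c  = inj₂ (forced z<y (s≤s y≤s) v<c (⊆-extend (suc s) rest sub))

S≡count : ∀ {n m} u v (good : List ℕ → Bool) →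
  (∀ {x} → T (isAscentSeq x) → (avoids x u ∧ avoids x v) ≡ good x) →
  S n m u v ≡ count (ascentSeqWith m good) (lists n n)
S≡count {n} {m} u v good avoids≡good =
  trans (length-filter-T? _ (lists n n)) (count-cong pointwise (lists n n))
  where
  pointwise : ∀ x → (isAscentSeq x ∧ (asc x ≡ᵇ m) ∧ avoids x u ∧ avoids x v) ≡ ascentSeqWith m good x
  pointwise x with isAscentSeq x in seq
  ... | false = refl
  ... | true  = cong ((asc x ≡ᵇ m) ∧_) (avoids≡good (Equivalence.from T-≡ seq))

avoids-0121-τ≡weakMaxima : ∀ {τ x} → ForcedByDescent τ → Violates zeroOrWeakMax τ → length τ ≡ 4 →
  T (isAscentSeq x) → (avoids x (0 ∷ 1 ∷ 2 ∷ 1 ∷ []) ∧ avoids x τ) ≡ allAgainstMax zeroOrWeakMax 0 x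
avoids-0121-τ≡weakMaxima {τ} {x} forced violates ∣τ∣≡4 seq = not∧not≡
  (λ good → avoid {0 ∷ 1 ∷ 2 ∷ 1 ∷ []} violatesWeak-0121 refl good , avoid {τ} violates ∣τ∣≡4 good)
  (weakMaxima-violation⇒contains {τ} {x} forced seq)
  where
  avoid : ∀ {σ} → Violates zeroOrWeakMax σ → length σ ≡ 4 → T (allAgainstMax zeroOrWeakMax 0 x) → ¬ T (contains x σ)
  avoid {σ} = allAgainstMax-avoids {τ = σ} {x = x} zeroOrWeakMax-antitone

avoids-0122-τ≡strictMaxima : ∀ {τ x} → ForcedByDescent τ → Violates smallOrStrictMax τ → length τ ≡ 4 →
  T (isAscentSeq x) → (avoids x (0 ∷ 1 ∷ 2 ∷ 2 ∷ []) ∧ avoids x τ) ≡ allAgainstMax smallOrStrictMax 0 x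
avoids-0122-τ≡strictMaxima {τ} {x} forced violates ∣τ∣≡4 seq = not∧not≡
  (λ good → avoid {0 ∷ 1 ∷ 2 ∷ 2 ∷ []} violatesStrict-0122 refl good , avoid {τ} violates ∣τ∣≡4 good)
  (strictMaxima-violation⇒contains {τ} {x} forced seq)
  where
  avoid : ∀ {σ} → Violates smallOrStrictMax σ → length σ ≡ 4 → T (allAgainstMax smallOrStrictMax 0 x) →
    ¬ T (contains x σ)
  avoid {σ} = allAgainstMax-avoids {τ = σ} {x = x} smallOrStrictMax-antitone

S-0121≡weakMaximaCount : ∀ n m τ → ForcedByDescent τ → Violates zeroOrWeakMax τ → length τ ≡ 4 →
  S n m (0 ∷ 1 ∷ 2 ∷ 1 ∷ []) τ ≡ weakMaximaCount n m
S-0121≡weakMaximaCount n m τ forced violates ∣τ∣≡4 = S≡count {n} {m} (0 ∷ 1 ∷ 2 ∷ 1 ∷ []) τ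
  (allAgainstMax zeroOrWeakMax 0) (λ {x} → avoids-0121-τ≡weakMaxima {τ} {x} forced violates ∣τ∣≡4)

S-0122≡strictMaximaCount : ∀ n m τ → ForcedByDescent τ → Violates smallOrStrictMax τ → length τ ≡ 4 →
  S n m (0 ∷ 1 ∷ 2 ∷ 2 ∷ []) τ ≡ strictMaximaCount n m
S-0122≡strictMaximaCount n m τ forced violates ∣τ∣≡4 = S≡count {n} {m} (0 ∷ 1 ∷ 2 ∷ 2 ∷ []) τ
  (allAgainstMax smallOrStrictMax 0) (λ {x} → avoids-0122-τ≡strictMaxima {τ} {x} forced violates ∣τ∣≡4)

proposition2 : (n m : ℕ) → 1 ≤ n → m < n →
    (S n m (0 ∷ 1 ∷ 2 ∷ 1 ∷ []) (0 ∷ 1 ∷ 3 ∷ 2 ∷ []) ≡ S n m (0 ∷ 1 ∷ 2 ∷ 1 ∷ []) (1 ∷ 0 ∷ 3 ∷ 2 ∷ []))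
    × (S n m (0 ∷ 1 ∷ 2 ∷ 1 ∷ []) (1 ∷ 0 ∷ 3 ∷ 2 ∷ []) ≡ S n m (0 ∷ 1 ∷ 2 ∷ 2 ∷ []) (0 ∷ 1 ∷ 3 ∷ 2 ∷ []))
    × (S n m (0 ∷ 1 ∷ 2 ∷ 2 ∷ []) (0 ∷ 1 ∷ 3 ∷ 2 ∷ []) ≡ S n m (0 ∷ 1 ∷ 2 ∷ 2 ∷ []) (1 ∷ 0 ∷ 3 ∷ 2 ∷ []))
proposition2 n m 1≤n _ =
  trans weak₀₁₃₂ (sym weak₁₀₃₂) ,
  trans weak₁₀₃₂ (trans (weakMaximaCount≡strictMaximaCount m 1≤n) (sym strict₀₁₃₂)) ,
  trans strict₀₁₃₂ (sym strict₁₀₃₂)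
  where
  weak₀₁₃₂ : S n m (0 ∷ 1 ∷ 2 ∷ 1 ∷ []) (0 ∷ 1 ∷ 3 ∷ 2 ∷ []) ≡ weakMaximaCount n m
  weak₀₁₃₂ = S-0121≡weakMaximaCount n m (0 ∷ 1 ∷ 3 ∷ 2 ∷ []) forced-0132 violatesWeak-0132 refl
  weak₁₀₃₂ : S n m (0 ∷ 1 ∷ 2 ∷ 1 ∷ []) (1 ∷ 0 ∷ 3 ∷ 2 ∷ []) ≡ weakMaximaCount n m
  weak₁₀₃₂ = S-0121≡weakMaximaCount n m (1 ∷ 0 ∷ 3 ∷ 2 ∷ []) forced-1032 violatesWeak-1032 refl
  strict₀₁₃₂ : S n m (0 ∷ 1 ∷ 2 ∷ 2 ∷ []) (0 ∷ 1 ∷ 3 ∷ 2 ∷ []) ≡ strictMaximaCount n m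
  strict₀₁₃₂ = S-0122≡strictMaximaCount n m (0 ∷ 1 ∷ 3 ∷ 2 ∷ []) forced-0132 violatesStrict-0132 refl
  strict₁₀₃₂ : S n m (0 ∷ 1 ∷ 2 ∷ 2 ∷ []) (1 ∷ 0 ∷ 3 ∷ 2 ∷ []) ≡ strictMaximaCount n m
  strict₁₀₃₂ = S-0122≡strictMaximaCount n m (1 ∷ 0 ∷ 3 ∷ 2 ∷ []) forced-1032 violatesStrict-1032 refl
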